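{- Let $\mathcal{V} = (V, \rho, <)$ and $\mathcal{W} = (W, \sigma, \sqsubset)$ be finite ordered oriented graphs and let $f : V \to W$ be a strong rigid quotient map from $\mathcal{V}$ to $\mathcal{W}$. Then $f : (V, <) \to (W, \sqsubset)$ is a rigid surjection, and $f : (V, \rho) \to (W, \sigma)$ is a quotient map.
   Context: An oriented graph is a pair $(V,\rho)$ where $\rho$ is a reflexive binary relation on $V$ such that for $v_1 \ne v_2$, $(v_1,v_2)\in\rho$ implies $(v_2,v_1)\notin\rho$. An ordered oriented graph is a triple $(V,\rho,<)$ where $(V,\rho)$ is an oriented graph and $<$ is a linear order on $V$. A homomorphism $f:(V,\rho)\to(W,\sigma)$ is a map with $(v_1,v_2)\in\rho \Rightarrow (f(v_1),f(v_2))\in\sigma$; it is a quotient map if it is surjective and for every $(w_1,w_2)\in\sigma$ there is $(v_1,v_2)\in\rho$ with $f(v_1)=w_1$, $f(v_2)=w_2$. A surjection $f$ between finite chains $(A,<)$ and $(B,\sqsubset)$ is rigid if $x \sqsubset y$ implies $\min f^{ -1}(x) < \min f^{ -1}(y)$. For a finite chain $(A,<)$: the anti-lexicographic order on $A^2$ is $(a_1,a_2) <_{alex} (b_1,b_2)$ iff $a_2<b_2$, or $a_2=b_2$ and $a_1<b_1$. On subsets, $X <_{alex} Y$ iff $X \subsetneq Y$, or $X,Y$ are incomparable and $\max(X\setminus Y) < \max(Y\setminus X)$. The order $<_{sal}$ on $A^2$ is defined by: if $a_1=a_2$ and $b_1=b_2$ then $(a_1,a_2)<_{sal}(b_1,b_2)$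 iff $a_1<b_1$; if $a_1=a_2$ and $b_1\ne b_2$ then $(a_1,a_2)<_{sal}(b_1,b_2)$; if $a_1\ne a_2$, $b_1\ne b_2$ and $\{a_1,a_2\}=\{b_1,b_2\}$ then $(a_1,a_2)<_{sal}(b_1,b_2)$ iff $(a_1,a_2)<_{alex}(b_1,b_2)$; if $a_1\ne a_2$, $b_1\ne b_2$ and $\{a_1,a_2\}\ne\{b_1,b_2\}$ then $(a_1,a_2)<_{sal}(b_1,b_2)$ iff $\{a_1,a_2\}<_{alex}\{b_1,b_2\}$. For an ordered oriented graph $(V,\rho,<)$ let $\Delta_V=\{(v,v):v\in V\}$, $\rho_< = \Delta_V \cup \{(v_1,v_2)\in\rho : v_1<v_2\}$, $\rho_> = \Delta_V\cup\{(v_1,v_2)\in\rho: v_1>v_2\}$. A homomorphism $f:(V,\rho)\to(W,\sigma)$ induces $\widehat f(v_1,v_2)=(f(v_1),f(v_2))$. $f$ is a strong rigid quotient map from $(V,\rho,<)$ to $(W,\sigma,\sqsubset)$ if $f$ is a homomorphism $(V,\rho)\to(W,\sigma)$ such that $\widehat f$ is a rigid surjection from $(\rho_<, <_{sal})$ onto $(\sigma_\sqsubset, \sqsubset_{sal})$ and $\widehat f$ is a rigid surjection from $((\rho_>)^{ -1}, <_{sal})$ onto $((\sigma_\sqsupset)^{ -1}, \sqsubset_{sal})$ (in particular $\widehat f$ maps these sets into the respective codomains). -}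

module Defs where

open import Level using (0ℓ)
open import Data.Nat using (ℕ)
open import Data.Fin using (Fin)
open import Data.Unit using (⊤)
open import Data.Product using (Σ; ∃; ∃-syntax; _×_; _,_; proj₁; proj₂)
open import Data.Sum using (_⊎_)
open import Relation.Nullary using (¬_)
open import Relation.Binary.PropositionalEquality using (_≡_; _≢_)
open import Relation.Binary.Structures using (IsStrictTotalOrder)
open import Function.Bundles using (_↔_)

Pred : Set → Set₁
Pred A = A → Set

_⊆_ : {A : Set} → Pred A → Pred A → Set
X ⊆ Y = ∀ z → X z → Y z

_∖_ : {A : Set} → Pred A → Pred A → Pred A
(X ∖ Y) z = X z × ¬ Y z

IsMin : {A : Set} → (A → A → Set) → Pred A → A → Set
IsMin _<_ P m = P m × (∀ a → P a → ¬ (a < m))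

IsMax : {A : Set} → (A → A → Set) → Pred A → A → Set
IsMax _<_ P m = P m × (∀ a → P a → ¬ (m < a))

-- Rigid surjections between (finite) chains, where the chains are given as
-- subsets P ⊆ A and Q ⊆ B of ambient ordered types.
-- g maps P into Q, is onto Q, and x ⊏ y implies min g⁻¹(x) < min g⁻¹(y).

record RigidSurjOn {A B : Set} (P : Pred A) (Q : Pred B)
                   (_<_ : A → A → Set) (_⊏_ : B → B → Set)
                   (g : A → B) : Set where
  field
    mapsInto : ∀ a → P a → Q (g a)
    onto     : ∀ b → Q b → ∃[ a ] (P a × g a ≡ b)
    rigid    : ∀ x y → Q x → Q y → x ⊏ y →
               ∀ a b → IsMin _<_ (λ z → P z × g z ≡ x) a
                     → IsMin _<_ (λ z → P z × g z ≡ y) b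
                     → a < b

RigidSurj : {A B : Set} (_<_ : A → A → Set) (_⊏_ : B → B → Set) (g : A → B) → Set
RigidSurj _<_ _⊏_ g = RigidSurjOn (λ _ → ⊤) (λ _ → ⊤) _<_ _⊏_ g

record OrderedOrientedGraph : Set₁ where
  field
    V        : Set
    size     : ℕ
    finite   : V ↔ Fin size
    ρ        : V → V → Set
    refl-ρ   : ∀ v → ρ v v
    oriented : ∀ v₁ v₂ → v₁ ≢ v₂ → ρ v₁ v₂ → ¬ ρ v₂ v₁
    _<_      : V → V → Set
    linear   : IsStrictTotalOrder _≡_ _<_

module Orders {A : Set} (_<_ : A → A → Set) where

  _<alex_ : A × A → A × A → Set
  (a₁ , a₂) <alex (b₁ , b₂) = (a₂ < b₂) ⊎ (a₂ ≡ b₂ × a₁ < b₁)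

  _<alexS_ : Pred A → Pred A → Set
  X <alexS Y =
      (X ⊆ Y × ¬ (Y ⊆ X))
    ⊎ ((¬ (X ⊆ Y) × ¬ (Y ⊆ X)) ×
       ∃[ m ] ∃[ n ] (IsMax _<_ (X ∖ Y) m × IsMax _<_ (Y ∖ X) n × m < n))

  pairSet : A × A → Pred A
  pairSet (a₁ , a₂) z = (z ≡ a₁) ⊎ (z ≡ a₂)

  _≐_ : Pred A → Pred A → Set
  X ≐ Y = X ⊆ Y × Y ⊆ X

  _<sal_ : A × A → A × A → Set
  (a₁ , a₂) <sal (b₁ , b₂) =
      (a₁ ≡ a₂ × b₁ ≡ b₂ × a₁ < b₁)
    ⊎ (a₁ ≡ a₂ × b₁ ≢ b₂)
    ⊎ (a₁ ≢ a₂ × b₁ ≢ b₂ × pairSet (a₁ , a₂) ≐ pairSet (b₁ , b₂)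
         × (a₁ , a₂) <alex (b₁ , b₂))
    ⊎ (a₁ ≢ a₂ × b₁ ≢ b₂ × ¬ (pairSet (a₁ , a₂) ≐ pairSet (b₁ , b₂))
         × pairSet (a₁ , a₂) <alexS pairSet (b₁ , b₂))

module Parts (G : OrderedOrientedGraph) where
  open OrderedOrientedGraph G

  ρ< : Pred (V × V)
  ρ< (v₁ , v₂) = (v₁ ≡ v₂) ⊎ (ρ v₁ v₂ × v₁ < v₂)

  ρ> : Pred (V × V)
  ρ> (v₁ , v₂) = (v₁ ≡ v₂) ⊎ (ρ v₁ v₂ × v₂ < v₁)

  ρ>⁻¹ : Pred (V × V)
  ρ>⁻¹ (v₁ , v₂) = ρ> (v₂ , v₁)

  _<sal_ : V × V → V × V → Set
  _<sal_ = Orders._<sal_ _<_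

pairMap : {V W : Set} → (V → W) → V × V → W × W
pairMap f (v₁ , v₂) = (f v₁ , f v₂)

module _ (G H : OrderedOrientedGraph) where
  private
    module G = OrderedOrientedGraph G
    module H = OrderedOrientedGraph H
    module PG = Parts G
    module PH = Parts H

  IsHomomorphism : (G.V → H.V) → Set
  IsHomomorphism f = ∀ v₁ v₂ → G.ρ v₁ v₂ → H.ρ (f v₁) (f v₂)

  IsQuotientMap : (G.V → H.V) → Set
  IsQuotientMap f =
      IsHomomorphism f
    × (∀ w → ∃[ v ] (f v ≡ w))
    × (∀ w₁ w₂ → H.ρ w₁ w₂ →
         ∃[ v₁ ] ∃[ v₂ ] (G.ρ v₁ v₂ × f v₁ ≡ w₁ × f v₂ ≡ w₂))

  IsStrongRigidQuotientMap : (G.V → H.V) → Set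
  IsStrongRigidQuotientMap f =
      IsHomomorphism f
    × RigidSurjOn PG.ρ< PH.ρ< PG._<sal_ PH._<sal_ (pairMap f)
    × RigidSurjOn PG.ρ>⁻¹ PH.ρ>⁻¹ PG._<sal_ PH._<sal_ (pairMap f)

-- The diagonal pairs (v , v) lie in ρ_< and form an initial segment of <_sal on
-- which <_sal agrees with <. So f̂ being onto the diagonal of σ_⊏ makes f onto,
-- and rigidity of f̂ on diagonal pairs is rigidity of f. An edge w₁ → w₂ of σ is
-- lifted through ρ_< when w₁ ⊏ w₂ and through (ρ_>)⁻¹ when w₂ ⊏ w₁; if the lift
-- happens to be a diagonal pair (v , v), then w₁ = w₂ = f v and the loop at v
-- is a lift.
module Submission where

open import Defs
open import Data.Product using (∃-syntax; _×_; _,_; proj₁; proj₂)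
open import Data.Sum using (inj₁; inj₂)
open import Data.Unit using (⊤; tt)
open import Data.Empty using (⊥-elim)
open import Relation.Nullary using (¬_)
open import Relation.Binary.PropositionalEquality using (_≡_; refl; cong)
open import Relation.Binary.Structures using (IsStrictTotalOrder)
open import Relation.Binary.Definitions using (tri<; tri≈; tri>)

module _ {A : Set} {_<_ : A → A → Set} where
  open Orders _<_

  <sal-diagonal⇒diagonal : ∀ {z₁ z₂ a} → (z₁ , z₂) <sal (a , a) → z₁ ≡ z₂ × z₁ < a
  <sal-diagonal⇒diagonal (inj₁ (z₁≡z₂ , _ , z₁<a))         = z₁≡z₂ , z₁<a
  <sal-diagonal⇒diagonal (inj₂ (inj₁ (_ , a≢a)))            = ⊥-elim (a≢a refl)
  <sal-diagonal⇒diagonal (inj₂ (inj₂ (inj₁ (_ , a≢a , _)))) = ⊥-elim (a≢a refl)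
  <sal-diagonal⇒diagonal (inj₂ (inj₂ (inj₂ (_ , a≢a , _)))) = ⊥-elim (a≢a refl)

module Lifting (G H : OrderedOrientedGraph) (f : OrderedOrientedGraph.V G → OrderedOrientedGraph.V H) where
  private
    module G = OrderedOrientedGraph G
    module H = OrderedOrientedGraph H
    module PG = Parts G
    module PH = Parts H

  EdgeLift : H.V → H.V → Set
  EdgeLift w₁ w₂ = ∃[ v₁ ] ∃[ v₂ ] (G.ρ v₁ v₂ × f v₁ ≡ w₁ × f v₂ ≡ w₂)

  loop-lift : ∀ v → EdgeLift (f v) (f v)
  loop-lift v = v , v , G.refl-ρ v , refl , refl

  min-fibre⇒min-diagonal-fibre : ∀ {x a} →
    IsMin G._<_ (λ z → ⊤ × f z ≡ x) a →
    IsMin PG._<sal_ (λ z → PG.ρ< z × pairMap f z ≡ (x , x)) (a , a)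
  min-fibre⇒min-diagonal-fibre {a = a} ((_ , refl) , a-min) = (inj₁ refl , refl) , below-a
    where
      below-a : ∀ z → PG.ρ< z × pairMap f z ≡ (f a , f a) → ¬ (z PG.<sal (a , a))
      below-a (z₁ , z₂) (_ , fz≡faa) z<aa =
        a-min z₁ (tt , cong proj₁ fz≡faa) (proj₂ (<sal-diagonal⇒diagonal z<aa))

  module _ (R< : RigidSurjOn PG.ρ< PH.ρ< PG._<sal_ PH._<sal_ (pairMap f)) where
    private module R< = RigidSurjOn R<

    rigidSurjOn-ρ<⇒surjective : ∀ w → ∃[ v ] f v ≡ w
    rigidSurjOn-ρ<⇒surjective w with R<.onto (w , w) (inj₁ refl)
    ... | (v , _) , _ , fv≡w = v , cong proj₁ fv≡w

    rigidSurjOn-ρ<⇒rigidSurj : RigidSurj G._<_ H._<_ f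
    rigidSurjOn-ρ<⇒rigidSurj = record
      { mapsInto = λ _ _ → tt
      ; onto     = λ w _ → let v , fv≡w = rigidSurjOn-ρ<⇒surjective w in v , tt , fv≡w
      ; rigid    = λ x y _ _ x⊏y a b a-min b-min →
          proj₂ (<sal-diagonal⇒diagonal
            (R<.rigid (x , x) (y , y) (inj₁ refl) (inj₁ refl) (inj₁ (refl , refl , x⊏y))
                      (a , a) (b , b)
                      (min-fibre⇒min-diagonal-fibre a-min)
                      (min-fibre⇒min-diagonal-fibre b-min)))
      }

    rigidSurjOn-ρ<⇒lift-ascending : ∀ {w₁ w₂} → H.ρ w₁ w₂ → w₁ H.< w₂ → EdgeLift w₁ w₂
    rigidSurjOn-ρ<⇒lift-ascending w₁w₂ w₁⊏w₂ with R<.onto _ (inj₂ (w₁w₂ , w₁⊏w₂))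
    ... | (v , _) , inj₁ refl , refl            = loop-lift v
    ... | (v₁ , v₂) , inj₂ (v₁v₂ , _) , refl = v₁ , v₂ , v₁v₂ , refl , refl

  rigidSurjOn-ρ>⁻¹⇒lift-descending :
    RigidSurjOn PG.ρ>⁻¹ PH.ρ>⁻¹ PG._<sal_ PH._<sal_ (pairMap f) →
    ∀ {w₁ w₂} → H.ρ w₁ w₂ → w₂ H.< w₁ → EdgeLift w₁ w₂
  rigidSurjOn-ρ>⁻¹⇒lift-descending R> w₁w₂ w₂⊏w₁ with RigidSurjOn.onto R> _ (inj₂ (w₁w₂ , w₂⊏w₁))
  ... | (v , _) , inj₁ refl , refl            = loop-lift v
  ... | (v₂ , v₁) , inj₂ (v₁v₂ , _) , refl = v₁ , v₂ , v₁v₂ , refl , refl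

mainTheorem1 : (G H : OrderedOrientedGraph) (f : OrderedOrientedGraph.V G → OrderedOrientedGraph.V H) →
    IsStrongRigidQuotientMap G H f →
    RigidSurj (OrderedOrientedGraph._<_ G) (OrderedOrientedGraph._<_ H) f × IsQuotientMap G H f
mainTheorem1 G H f (hom , R< , R>) =
  rigidSurjOn-ρ<⇒rigidSurj R< , hom , rigidSurjOn-ρ<⇒surjective R< , lift
  where
    open OrderedOrientedGraph H using (ρ; linear)
    open Lifting G H f

    lift : ∀ w₁ w₂ → ρ w₁ w₂ → EdgeLift w₁ w₂
    lift w₁ w₂ w₁w₂ with IsStrictTotalOrder.compare linear w₁ w₂
    ... | tri< w₁⊏w₂ _ _ = rigidSurjOn-ρ<⇒lift-ascending R< w₁w₂ w₁⊏w₂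
    ... | tri> _ _ w₂⊏w₁ = rigidSurjOn-ρ>⁻¹⇒lift-descending R> w₁w₂ w₂⊏w₁
    ... | tri≈ _ refl _ with rigidSurjOn-ρ<⇒surjective R< w₁
    ...   | v , refl = loop-lift v
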